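{- Let $S=\{z_1,\dots,z_n\}\subseteq\mathbb{Q}[\mathbf{i}]$ be such that $|z_j|=|z_k|$ for all $j,k$, and write $n=2^s m$ with $s\in\mathbb{Z}_{\ge0}$ and $m$ odd. Define multisets $T_0=S$ and $T_j=(T_{j-1})_\times$ for $j=1,\dots,s$. Then $M_1(T_s)$ is a polynomial in $M_1(S),M_2(S),M_4(S),\dots,M_{2^s}(S)$ with zero constant term.
   Context: $\mathbb{Q}[\mathbf{i}]=\{x+y\mathbf{i}:x,y\in\mathbb{Q}\}$. For a multiset $T=\{u_1,\dots,u_N\}$ of complex numbers, $T_\times$ denotes the multiset $\{u_ju_k: 1\le j<k\le N\}$ (of size $\binom N2$). For a finite multiset $X\subseteq\mathbb{C}$ and integer $k\ge0$, $M_k(X)=\sum_{z\in X}z^k$ (with multiplicity). -}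

module Defs where

open import Data.Nat as ℕ using (ℕ; zero; suc; _%_)
open import Data.Fin using (Fin)
open import Data.List using (List; []; _∷_; map; _++_; foldr)
open import Data.Rational as ℚ using (ℚ; 0ℚ; 1ℚ)
open import Relation.Binary.PropositionalEquality using (_≡_)

record ℚ[i] : Set where
  constructor _+_i
  field
    re : ℚ
    im : ℚ
open ℚ[i] public

0ᵍ : ℚ[i]
0ᵍ = 0ℚ + 0ℚ i

1ᵍ : ℚ[i]
1ᵍ = 1ℚ + 0ℚ i

_+ᵍ_ : ℚ[i] → ℚ[i] → ℚ[i]
(a + b i) +ᵍ (c + d i) = (a ℚ.+ c) + (b ℚ.+ d) i

_*ᵍ_ : ℚ[i] → ℚ[i] → ℚ[i]
(a + b i) *ᵍ (c + d i) = ((a ℚ.* c) ℚ.- (b ℚ.* d)) + ((a ℚ.* d) ℚ.+ (b ℚ.* c)) i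

_^ᵍ_ : ℚ[i] → ℕ → ℚ[i]
z ^ᵍ zero = 1ᵍ
z ^ᵍ suc k = z *ᵍ (z ^ᵍ k)

-- |z|² = re² + im²  (|z| = |w| iff |z|² = |w|², as moduli are ≥ 0)
normSq : ℚ[i] → ℚ
normSq (a + b i) = (a ℚ.* a) ℚ.+ (b ℚ.* b)

-- multisets of complex numbers are represented as lists (order irrelevant)
-- M_k(X) = Σ_{z ∈ X} z^k
M : ℕ → List ℚ[i] → ℚ[i]
M k X = foldr (λ z acc → (z ^ᵍ k) +ᵍ acc) 0ᵍ X

pairProducts : List ℚ[i] → List ℚ[i]
pairProducts [] = []
pairProducts (u ∷ us) = map (u *ᵍ_) us ++ pairProducts us

T : ℕ → List ℚ[i] → List ℚ[i]
T zero S = S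
T (suc j) S = pairProducts (T j S)

data Poly (k : ℕ) : Set where
  con  : ℚ[i] → Poly k
  var  : Fin k → Poly k
  _⊕_ : Poly k → Poly k → Poly k
  _⊗_ : Poly k → Poly k → Poly k

eval : ∀ {k} → Poly k → (Fin k → ℚ[i]) → ℚ[i]
eval (con c) ρ = c
eval (var x) ρ = ρ x
eval (p ⊕ q) ρ = eval p ρ +ᵍ eval q ρ
eval (p ⊗ q) ρ = eval p ρ *ᵍ eval q ρ

ZeroConstantTerm : ∀ {k} → Poly k → Set
ZeroConstantTerm p = eval p (λ _ → 0ᵍ) ≡ 0ᵍ

Odd : ℕ → Set
Odd m = m % 2 ≡ 1

{-# OPTIONS --safe #-}
-- Newton's identity e₂ = ½ p₁² − ½ p₂, applied to the k-th powers of the elements of X,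
-- gives M_k(X_×) = ½ M_k(X)² − ½ M_{2k}(X). Iterating it s times writes M_1(T_s) as a
-- polynomial in M_1(S), M_2(S), …, M_{2^s}(S); that polynomial has no constant term
-- because it evaluates to M_1(T_s) = 0 on the empty multiset.
module Submission where

open import Defs
open import Algebra.Bundles using (CommutativeRing)
open import Algebra.Consequences.Propositional using (comm∧idˡ⇒id; comm∧invˡ⇒inv; comm∧distrˡ⇒distrʳ)
open import Data.Fin as Fin using (Fin; toℕ; inject₁)
open import Data.Fin.Properties using (toℕ-inject₁)
open import Data.List using (List; []; _∷_; map; _++_; length)
open import Data.List.Membership.Propositional using (_∈_)
open import Data.Nat using (ℕ; zero; suc)
open import Data.Nat.Properties using (*-identityˡ; *-identityʳ)
import Data.Nat.Tactic.RingSolver as ℕ-Solver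
open import Data.Product using (Σ; _×_; _,_; uncurry)
open import Data.Rational using (0ℚ; 1ℚ; ½)
import Data.Rational.Properties as ℚ
open import Function using (_∘_)
open import Relation.Binary.Definitions using (DecidableEquality)
open import Relation.Binary.PropositionalEquality
open import Relation.Nullary using (dec⇒maybe; map′; _×-dec_)
open import Tactic.RingSolver using (solve-∀)
import Tactic.RingSolver.Core.AlmostCommutativeRing as ACR
open import Algebra.Structures {A = ℚ[i]} _≡_ using (IsCommutativeRing)

module _ where
  open import Data.Rational using (_+_; _*_; _-_; -_)

  ℚ-ring : ACR.AlmostCommutativeRing _ _
  ℚ-ring = ACR.fromCommutativeRing ℚ.+-*-commutativeRing (dec⇒maybe ∘ (0ℚ ℚ.≟_))

  -ᵍ_ : ℚ[i] → ℚ[i]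
  -ᵍ (a + b i) = (- a) + (- b) i

  _≟ᵍ_ : DecidableEquality ℚ[i]
  (a + b i) ≟ᵍ (c + d i) =
    map′ (uncurry (cong₂ _+_i)) (λ eq → cong re eq , cong im eq) ((a ℚ.≟ c) ×-dec (b ℚ.≟ d))

  +ᵍ-assoc : ∀ x y z → (x +ᵍ y) +ᵍ z ≡ x +ᵍ (y +ᵍ z)
  +ᵍ-assoc (a + b i) (c + d i) (e + f i) = cong₂ _+_i (ℚ.+-assoc a c e) (ℚ.+-assoc b d f)

  +ᵍ-comm : ∀ x y → x +ᵍ y ≡ y +ᵍ x
  +ᵍ-comm (a + b i) (c + d i) = cong₂ _+_i (ℚ.+-comm a c) (ℚ.+-comm b d)

  +ᵍ-identityˡ : ∀ x → 0ᵍ +ᵍ x ≡ x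
  +ᵍ-identityˡ (a + b i) = cong₂ _+_i (ℚ.+-identityˡ a) (ℚ.+-identityˡ b)

  -ᵍ‿inverseˡ : ∀ x → (-ᵍ x) +ᵍ x ≡ 0ᵍ
  -ᵍ‿inverseˡ (a + b i) = cong₂ _+_i (ℚ.+-inverseˡ a) (ℚ.+-inverseˡ b)

  *ᵍ-assoc : ∀ x y z → (x *ᵍ y) *ᵍ z ≡ x *ᵍ (y *ᵍ z)
  *ᵍ-assoc (a + b i) (c + d i) (e + f i) = cong₂ _+_i (re-assoc a b c d e f) (im-assoc a b c d e f)
    where
    re-assoc : ∀ a b c d e f →
      (a * c - b * d) * e - (a * d + b * c) * f ≡ a * (c * e - d * f) - b * (c * f + d * e)
    re-assoc = solve-∀ ℚ-ring
    im-assoc : ∀ a b c d e f →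
      (a * c - b * d) * f + (a * d + b * c) * e ≡ a * (c * f + d * e) + b * (c * e - d * f)
    im-assoc = solve-∀ ℚ-ring

  *ᵍ-comm : ∀ x y → x *ᵍ y ≡ y *ᵍ x
  *ᵍ-comm (a + b i) (c + d i) = cong₂ _+_i (re-comm a b c d) (im-comm a b c d)
    where
    re-comm : ∀ a b c d → a * c - b * d ≡ c * a - d * b
    re-comm = solve-∀ ℚ-ring
    im-comm : ∀ a b c d → a * d + b * c ≡ c * b + d * a
    im-comm = solve-∀ ℚ-ring

  *ᵍ-identityˡ : ∀ x → 1ᵍ *ᵍ x ≡ x
  *ᵍ-identityˡ (a + b i) = cong₂ _+_i (re-identity a b) (im-identity a b)
    where
    re-identity : ∀ a b → 1ℚ * a - 0ℚ * b ≡ a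
    re-identity = solve-∀ ℚ-ring
    im-identity : ∀ a b → 1ℚ * b + 0ℚ * a ≡ b
    im-identity = solve-∀ ℚ-ring

  *ᵍ-distribˡ-+ᵍ : ∀ x y z → x *ᵍ (y +ᵍ z) ≡ (x *ᵍ y) +ᵍ (x *ᵍ z)
  *ᵍ-distribˡ-+ᵍ (a + b i) (c + d i) (e + f i) =
    cong₂ _+_i (re-distrib a b c d e f) (im-distrib a b c d e f)
    where
    re-distrib : ∀ a b c d e f → a * (c + e) - b * (d + f) ≡ (a * c - b * d) + (a * e - b * f)
    re-distrib = solve-∀ ℚ-ring
    im-distrib : ∀ a b c d e f → a * (d + f) + b * (c + e) ≡ (a * d + b * c) + (a * f + b * e)
    im-distrib = solve-∀ ℚ-ring

open import Data.Nat using (_+_; _*_; _^_)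

ℚ[i]-isCommutativeRing : IsCommutativeRing _+ᵍ_ _*ᵍ_ -ᵍ_ 0ᵍ 1ᵍ
ℚ[i]-isCommutativeRing = record
  { isRing = record
    { +-isAbelianGroup = record
      { isGroup = record
        { isMonoid = record
          { isSemigroup = record
            { isMagma = record { isEquivalence = isEquivalence ; ∙-cong = cong₂ _+ᵍ_ }
            ; assoc = +ᵍ-assoc
            }
          ; identity = comm∧idˡ⇒id +ᵍ-comm +ᵍ-identityˡ
          }
        ; inverse = comm∧invˡ⇒inv +ᵍ-comm -ᵍ‿inverseˡ
        ; ⁻¹-cong = cong -ᵍ_
        }
      ; comm = +ᵍ-comm
      }
    ; *-cong = cong₂ _*ᵍ_
    ; *-assoc = *ᵍ-assoc
    ; *-identity = comm∧idˡ⇒id *ᵍ-comm *ᵍ-identityˡ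
    ; distrib = *ᵍ-distribˡ-+ᵍ , comm∧distrˡ⇒distrʳ *ᵍ-comm *ᵍ-distribˡ-+ᵍ
    }
  ; *-comm = *ᵍ-comm
  }

ℚ[i]-commutativeRing : CommutativeRing _ _
ℚ[i]-commutativeRing = record { isCommutativeRing = ℚ[i]-isCommutativeRing }

open CommutativeRing ℚ[i]-commutativeRing using (commutativeSemiring; zeroʳ)
import Algebra.Properties.CommutativeSemiring.Exp commutativeSemiring as Exp

ℚ[i]-ring : ACR.AlmostCommutativeRing _ _
ℚ[i]-ring = ACR.fromCommutativeRing ℚ[i]-commutativeRing (dec⇒maybe ∘ (0ᵍ ≟ᵍ_))

^ᵍ≡^ : ∀ x k → x ^ᵍ k ≡ x Exp.^ k
^ᵍ≡^ x zero    = refl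
^ᵍ≡^ x (suc k) = cong (x *ᵍ_) (^ᵍ≡^ x k)

^ᵍ-distrib-*ᵍ : ∀ x y k → (x *ᵍ y) ^ᵍ k ≡ (x ^ᵍ k) *ᵍ (y ^ᵍ k)
^ᵍ-distrib-*ᵍ x y k rewrite ^ᵍ≡^ (x *ᵍ y) k | ^ᵍ≡^ x k | ^ᵍ≡^ y k = Exp.^-distrib-* x y k

^ᵍ-homo-*ᵍ : ∀ x k l → x ^ᵍ (k + l) ≡ (x ^ᵍ k) *ᵍ (x ^ᵍ l)
^ᵍ-homo-*ᵍ x k l rewrite ^ᵍ≡^ x (k + l) | ^ᵍ≡^ x k | ^ᵍ≡^ x l = Exp.^-homo-* x k l

M-++ : ∀ k X Y → M k (X ++ Y) ≡ M k X +ᵍ M k Y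
M-++ k []      Y = sym (+ᵍ-identityˡ (M k Y))
M-++ k (z ∷ X) Y = trans (cong ((z ^ᵍ k) +ᵍ_) (M-++ k X Y)) (sym (+ᵍ-assoc (z ^ᵍ k) (M k X) (M k Y)))

M-map-*ᵍ : ∀ k u X → M k (map (u *ᵍ_) X) ≡ (u ^ᵍ k) *ᵍ M k X
M-map-*ᵍ k u []      = sym (zeroʳ (u ^ᵍ k))
M-map-*ᵍ k u (z ∷ X) = begin
  ((u *ᵍ z) ^ᵍ k) +ᵍ M k (map (u *ᵍ_) X)          ≡⟨ cong₂ _+ᵍ_ (^ᵍ-distrib-*ᵍ u z k) (M-map-*ᵍ k u X) ⟩
  ((u ^ᵍ k) *ᵍ (z ^ᵍ k)) +ᵍ ((u ^ᵍ k) *ᵍ M k X)   ≡⟨ sym (*ᵍ-distribˡ-+ᵍ (u ^ᵍ k) (z ^ᵍ k) (M k X)) ⟩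
  (u ^ᵍ k) *ᵍ ((z ^ᵍ k) +ᵍ M k X)                 ∎
  where open ≡-Reasoning

½ᵍ : ℚ[i]
½ᵍ = ½ + 0ℚ i

newton-step : ∀ a p q →
  (a *ᵍ p) +ᵍ ((½ᵍ *ᵍ (p *ᵍ p)) +ᵍ ((-ᵍ ½ᵍ) *ᵍ q))
    ≡ (½ᵍ *ᵍ ((a +ᵍ p) *ᵍ (a +ᵍ p))) +ᵍ ((-ᵍ ½ᵍ) *ᵍ ((a *ᵍ a) +ᵍ q))
newton-step = solve-∀ ℚ[i]-ring

M-pairProducts : ∀ k X →
  M k (pairProducts X) ≡ (½ᵍ *ᵍ (M k X *ᵍ M k X)) +ᵍ ((-ᵍ ½ᵍ) *ᵍ M (k + k) X)
M-pairProducts k []      = refl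
M-pairProducts k (u ∷ X) = begin
  M k (map (u *ᵍ_) X ++ pairProducts X)
    ≡⟨ M-++ k (map (u *ᵍ_) X) (pairProducts X) ⟩
  M k (map (u *ᵍ_) X) +ᵍ M k (pairProducts X)
    ≡⟨ cong₂ _+ᵍ_ (M-map-*ᵍ k u X) (M-pairProducts k X) ⟩
  ((u ^ᵍ k) *ᵍ M k X) +ᵍ ((½ᵍ *ᵍ (M k X *ᵍ M k X)) +ᵍ ((-ᵍ ½ᵍ) *ᵍ M (k + k) X))
    ≡⟨ newton-step (u ^ᵍ k) (M k X) (M (k + k) X) ⟩
  (½ᵍ *ᵍ (M k (u ∷ X) *ᵍ M k (u ∷ X))) +ᵍ ((-ᵍ ½ᵍ) *ᵍ (((u ^ᵍ k) *ᵍ (u ^ᵍ k)) +ᵍ M (k + k) X))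
    ≡⟨ cong (λ t → (½ᵍ *ᵍ (M k (u ∷ X) *ᵍ M k (u ∷ X))) +ᵍ ((-ᵍ ½ᵍ) *ᵍ (t +ᵍ M (k + k) X)))
            (sym (^ᵍ-homo-*ᵍ u k k)) ⟩
  (½ᵍ *ᵍ (M k (u ∷ X) *ᵍ M k (u ∷ X))) +ᵍ ((-ᵍ ½ᵍ) *ᵍ M (k + k) (u ∷ X))
    ∎
  where open ≡-Reasoning

T-[] : ∀ j → T j [] ≡ []
T-[] zero    = refl
T-[] (suc j) = cong pairProducts (T-[] j)

rename : ∀ {k l} → (Fin k → Fin l) → Poly k → Poly l
rename f (con c) = con c
rename f (var x) = var (f x)
rename f (p ⊕ q) = rename f p ⊕ rename f q
rename f (p ⊗ q) = rename f p ⊗ rename f q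

eval-rename : ∀ {k l} (f : Fin k → Fin l) p ρ → eval (rename f p) ρ ≡ eval p (ρ ∘ f)
eval-rename f (con c) ρ = refl
eval-rename f (var x) ρ = refl
eval-rename f (p ⊕ q) ρ = cong₂ _+ᵍ_ (eval-rename f p ρ) (eval-rename f q ρ)
eval-rename f (p ⊗ q) ρ = cong₂ _*ᵍ_ (eval-rename f p ρ) (eval-rename f q ρ)

-- Variable x stands for the power sum of exponent 2^x; renaming along Fin.suc doubles
-- every exponent.
newtonPoly : (j : ℕ) → Poly (suc j)
newtonPoly zero    = var Fin.zero
newtonPoly (suc j) = (con ½ᵍ ⊗ (low ⊗ low)) ⊕ (con (-ᵍ ½ᵍ) ⊗ rename Fin.suc (newtonPoly j))
  where
  low : Poly (suc (suc j))
  low = rename inject₁ (newtonPoly j)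

eval-newtonPoly : ∀ j k S (ρ : Fin (suc j) → ℚ[i]) → (∀ x → ρ x ≡ M (k * 2 ^ toℕ x) S) →
  eval (newtonPoly j) ρ ≡ M k (T j S)
eval-newtonPoly zero    k S ρ ρ≡M = trans (ρ≡M Fin.zero) (cong (λ e → M e S) (*-identityʳ k))
eval-newtonPoly (suc j) k S ρ ρ≡M = begin
  (½ᵍ *ᵍ (eval low ρ *ᵍ eval low ρ)) +ᵍ ((-ᵍ ½ᵍ) *ᵍ eval high ρ)
    ≡⟨ cong₂ (λ a b → (½ᵍ *ᵍ (a *ᵍ a)) +ᵍ ((-ᵍ ½ᵍ) *ᵍ b)) low≡M high≡M ⟩
  (½ᵍ *ᵍ (M k (T j S) *ᵍ M k (T j S))) +ᵍ ((-ᵍ ½ᵍ) *ᵍ M (k + k) (T j S))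
    ≡⟨ sym (M-pairProducts k (T j S)) ⟩
  M k (T (suc j) S)
    ∎
  where
  open ≡-Reasoning
  low high : Poly (suc (suc j))
  low  = rename inject₁ (newtonPoly j)
  high = rename Fin.suc (newtonPoly j)
  m*[2*n]≡[m+m]*n : ∀ m n → m * (2 * n) ≡ (m + m) * n
  m*[2*n]≡[m+m]*n = ℕ-Solver.solve-∀
  low≡M : eval low ρ ≡ M k (T j S)
  low≡M = trans (eval-rename inject₁ (newtonPoly j) ρ) (eval-newtonPoly j k S (ρ ∘ inject₁)
    (λ x → trans (ρ≡M (inject₁ x)) (cong (λ e → M (k * 2 ^ e) S) (toℕ-inject₁ x))))
  high≡M : eval high ρ ≡ M (k + k) (T j S)
  high≡M = trans (eval-rename Fin.suc (newtonPoly j) ρ) (eval-newtonPoly j (k + k) S (ρ ∘ Fin.suc)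
    (λ x → trans (ρ≡M (Fin.suc x)) (cong (λ e → M e S) (m*[2*n]≡[m+m]*n k (2 ^ toℕ x)))))

lemma3p5 : (s m : ℕ) → Odd m →
    Σ (Poly (suc s)) λ P → ZeroConstantTerm P ×
      ((S : List ℚ[i]) → length S ≡ 2 ^ s * m →
        (∀ z w → z ∈ S → w ∈ S → normSq z ≡ normSq w) →
        M 1 (T s S) ≡ eval P (λ i → M (2 ^ toℕ i) S))
lemma3p5 s _ _ = newtonPoly s , vanishes-at-0 , λ S _ _ → sym (eval-newtonPoly s 1 S _ (power-sums S))
  where
  power-sums : ∀ S x → M (2 ^ toℕ x) S ≡ M (1 * 2 ^ toℕ x) S
  power-sums S x = cong (λ e → M e S) (sym (*-identityˡ (2 ^ toℕ x)))
  vanishes-at-0 : eval (newtonPoly s) (λ _ → 0ᵍ) ≡ 0ᵍ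
  vanishes-at-0 = trans (eval-newtonPoly s 1 [] _ (λ _ → refl)) (cong (M 1) (T-[] s))
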